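{- Let $\pi$ be an increasing oscillation of length at least $4$, let $r\ge1$, and let $\alpha$ be one of $21$, $\odot^k(21)$ ($k\ge2$), $1\odot(\odot^k(21))$ ($k\ge1$), $(\odot^k(21))\odot1$ ($k\ge1$), $1\odot(\odot^k(21))\odot1$ ($k\ge1$). If $\oplus^r\alpha\le\pi$, then the following inequality holds: - if $\alpha=21$: $3r-1\le 2n$ when $\pi\in\{W_{2n},M_{2n}\}$, and $3r\le2n$ when $\pi\in\{W_{2n-1},M_{2n-1}\}$; - if $\pi=W_{2n}$ and $\alpha=\odot^k(21)$: $2kr+2r-2\le2n$; - if $\pi=W_{2n-1}$ and $\alpha=1\odot(\odot^k(21))$: $2kr+2r+2\le2n$; - if $\pi=M_{2n-1}$ and $\alpha=(\odot^k(21))\odot1$: $2kr+2r+2\le2n$; - if $\pi=M_{2n}$ and $\alpha=1\odot(\odot^k(21))\odot1$: $2kr+4r-2\le2n$; - if $\pi\in\{W_{2n},W_{2n-1},M_{2n-1}\}$ and $\alpha=1\odot(\odot^k(21))\odot1$: $2kr+4r\le2n$; - in all other cases: $2kr+2r\le2n$.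
   Context: Permutations are nonempty finite permutations in one-line notation; $\sigma\le\pi$ means $\sigma$ is contained in $\pi$ as a pattern (there are positions $i_1<\dots<i_m$ with $\pi_{i_r}<\pi_{i_s}$ iff $\sigma_r<\sigma_s$). For $\alpha$ of length $m$ and $\beta$ of length $n$, $\alpha\oplus\beta=\alpha_1\cdots\alpha_m(\beta_1+m)\cdots(\beta_n+m)$, and $\oplus^r\alpha$ is the sum of $r$ copies of $\alpha$. The interleave $\alpha\odot\beta$ is obtained from $\alpha\oplus\beta$ by exchanging the value of the largest entry coming from $\alpha$ with the value of the smallest entry coming from $\beta$; e.g. $321\odot213=421536$. $\odot^n(21)=21\odot\cdots\odot21$ ($n$ copies), e.g. $\odot^3(21)=315264$; expressions like $1\odot X\odot1$ are unambiguous. Increasing oscillations of length at least $4$ are exactly $W_N,M_N$ ($N\ge4$), where $W_{2n}=\odot^n(21)$, $W_{2n-1}=(\odot^{n-1}(21))\odot1$, $M_{2n}=1\odot(\odot^{n-1}(21))\odot1$, $M_{2n-1}=1\odot(\odot^{n-1}(21))$; e.g. $W_4=3142$, $W_5=31524$, $M_4=2413$. Here $n$ denotes the integer for which $\pi$ has length $2n$ or $2n-1$ as indicated. -}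

module Defs where

open import Data.Nat using (ℕ; zero; suc; _+_; _*_; _∸_; _≤_; _<_; _≡ᵇ_)
open import Data.Bool using (if_then_else_)
open import Data.List using (List; []; _∷_; _++_; map; length; lookup)
open import Data.List.Relation.Binary.Sublist.Propositional using (_⊆_)
open import Data.Fin using (Fin; cast)
open import Data.Product using (Σ; ∃; _×_)
open import Function.Bundles using (_⇔_)
open import Relation.Binary.PropositionalEquality using (_≡_)

-- Permutations in one-line notation, as lists of positive naturals (values 1..m).

OrderIso : List ℕ → List ℕ → Set
OrderIso σ τ =
  Σ (length σ ≡ length τ) λ eq →
    ∀ (i j : Fin (length σ)) →
      (lookup σ i < lookup σ j) ⇔ (lookup τ (cast eq i) < lookup τ (cast eq j))

_≼_ : List ℕ → List ℕ → Set
σ ≼ π = ∃ λ τ → (τ ⊆ π) × OrderIso σ τ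

_⊕_ : List ℕ → List ℕ → List ℕ
α ⊕ β = α ++ map (λ x → x + length α) β

swapVal : ℕ → ℕ → ℕ
swapVal m x = if x ≡ᵇ m then suc m else (if x ≡ᵇ suc m then m else x)

-- Interleave α ⊙ β: in α ⊕ β exchange the largest value from α (namely m = |α|)
-- with the smallest value from β (namely m+1).
_⊙_ : List ℕ → List ℕ → List ℕ
α ⊙ β = map (swapVal (length α)) (α ⊕ β)

infixl 6 _⊕_
infixl 6 _⊙_

sumPow : ℕ → List ℕ → List ℕ
sumPow zero    α = []
sumPow (suc r) α = α ⊕ sumPow r α

p21 : List ℕ
p21 = 2 ∷ 1 ∷ []

p1 : List ℕ
p1 = 1 ∷ []

-- ⊙^k(21) for k ≥ 1 (the value at 0 is an unused placeholder).
odot21 : ℕ → List ℕ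
odot21 zero = []
odot21 (suc zero) = p21
odot21 (suc (suc k)) = p21 ⊙ odot21 (suc k)

data OscShape : Set where
  Weven Wodd Meven Modd : OscShape

-- osc Weven n = W_{2n}, osc Wodd n = W_{2n-1}, osc Meven n = M_{2n}, osc Modd n = M_{2n-1}.
osc : OscShape → ℕ → List ℕ
osc Weven n = odot21 n
osc Wodd  n = odot21 (n ∸ 1) ⊙ p1
osc Meven n = p1 ⊙ odot21 (n ∸ 1) ⊙ p1
osc Modd  n = p1 ⊙ odot21 (n ∸ 1)

data AlphaShape : Set where
  a21   : AlphaShape
  aW    : ℕ → AlphaShape
  aL    : ℕ → AlphaShape
  aR    : ℕ → AlphaShape
  aLR   : ℕ → AlphaShape

AlphaOK : AlphaShape → Set
AlphaOK a21     = 1 ≤ 1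
AlphaOK (aW k)  = 2 ≤ k
AlphaOK (aL k)  = 1 ≤ k
AlphaOK (aR k)  = 1 ≤ k
AlphaOK (aLR k) = 1 ≤ k

alpha : AlphaShape → List ℕ
alpha a21     = p21
alpha (aW k)  = odot21 k
alpha (aL k)  = p1 ⊙ odot21 k
alpha (aR k)  = odot21 k ⊙ p1
alpha (aLR k) = p1 ⊙ odot21 k ⊙ p1

bound : AlphaShape → OscShape → ℕ → ℕ
bound a21 Weven r = 3 * r ∸ 1
bound a21 Meven r = 3 * r ∸ 1
bound a21 Wodd  r = 3 * r
bound a21 Modd  r = 3 * r
bound (aW k) Weven r = 2 * k * r + 2 * r ∸ 2
bound (aL k) Wodd  r = 2 * k * r + 2 * r + 2
bound (aR k) Modd  r = 2 * k * r + 2 * r + 2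
bound (aLR k) Meven r = 2 * k * r + 4 * r ∸ 2
bound (aLR k) Weven r = 2 * k * r + 4 * r
bound (aLR k) Wodd  r = 2 * k * r + 4 * r
bound (aLR k) Modd  r = 2 * k * r + 4 * r
bound (aW k) Wodd  r = 2 * k * r + 2 * r
bound (aW k) Meven r = 2 * k * r + 2 * r
bound (aW k) Modd  r = 2 * k * r + 2 * r
bound (aL k) Weven r = 2 * k * r + 2 * r
bound (aL k) Meven r = 2 * k * r + 2 * r
bound (aL k) Modd  r = 2 * k * r + 2 * r
bound (aR k) Weven r = 2 * k * r + 2 * r
bound (aR k) Wodd  r = 2 * k * r + 2 * r
bound (aR k) Meven r = 2 * k * r + 2 * r

-- An increasing oscillation is order-isomorphic to a set of positions of the infinite
-- oscillation ω = 3 0 5 2 7 4 …, chosen so that their ranks along the inversion path of ω form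
-- an interval; along that path consecutive inversions alternate in orientation. An occurrence of
-- an oscillation α of length L ≥ 3 in π maps inversions to inversions and ascents to ascents, so
-- it maps the path of α onto L consecutive ranks of π, with the orientation, hence the parity of
-- the first rank, prescribed by α. In an occurrence of ⊕^r α different copies form ascents, so
-- their rank intervals are separated by an unused rank. Counting ranks, in halves when the parity
-- is prescribed, gives the bounds.

module Submission where

open import Defs
open import Data.Bool using (true; false)
open import Data.Empty using (⊥-elim)
open import Data.Fin using (Fin; toℕ; fromℕ<; cast)
import Data.Fin as Fin
open import Data.Fin.Properties using (toℕ-cast; toℕ-fromℕ<)
open import Data.List using (List; []; _∷_; _++_; [_]; map; length; lookup; applyUpTo)
open import Data.List.Properties
  using (map-++; length-++; length-map; length-applyUpTo; map-applyUpTo; applyUpTo-∷ʳ)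
open import Data.List.Relation.Binary.Sublist.Heterogeneous using (Sublist; []; _∷_; _∷ʳ_)
open import Data.Nat using (ℕ; zero; suc; _+_; _*_; _∸_; _≤_; _<_; z≤n; s≤s; _≡ᵇ_; _⊔_; _⊓_; pred)
open import Data.Nat using (_≟_; _<?_; _≤?_; parity; ⌊_/2⌋)
open import Data.Nat.Properties
open import Data.Nat.Tactic.RingSolver using (solve-∀)
open import Data.Parity using (Parity; 0ℙ; 1ℙ)
open import Data.Product using (Σ; _×_; _,_; proj₁; proj₂)
open import Data.Sum using (_⊎_; inj₁; inj₂)
open import Function.Bundles using (Equivalence)
open import Relation.Binary.Definitions using (tri<; tri≈; tri>)
open import Relation.Binary.PropositionalEquality hiding ([_])
open import Relation.Nullary using (¬_; yes; no)

-- The infinite increasing oscillation ω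

double : ℕ → ℕ
double zero    = zero
double (suc a) = suc (suc (double a))

-- ω lists the values of 3 0 5 2 7 4 9 6 …; its inversions are the pairs of positions that are
-- adjacent on the path 1 – 0 – 3 – 2 – 5 – 4 – …, and rank p is the place of p on that path.
ω : ℕ → ℕ
ω 0 = 3
ω 1 = 0
ω (suc (suc p)) = suc (suc (ω p))

rank : ℕ → ℕ
rank 0 = 1
rank 1 = 0
rank (suc (suc p)) = suc (suc (rank p))

rank-involutive : ∀ p → rank (rank p) ≡ p
rank-involutive 0 = refl
rank-involutive 1 = refl
rank-involutive (suc (suc p)) = cong (λ x → suc (suc x)) (rank-involutive p)

rank-injective : ∀ {p p′} → rank p ≡ rank p′ → p ≡ p′
rank-injective {p} {p′} eq = trans (sym (rank-involutive p)) (trans (cong rank eq) (rank-involutive p′))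

rank-double : ∀ a → rank (double a) ≡ suc (double a)
rank-double zero    = refl
rank-double (suc a) = cong (λ x → suc (suc x)) (rank-double a)

rank-suc-double : ∀ a → rank (suc (double a)) ≡ double a
rank-suc-double zero    = refl
rank-suc-double (suc a) = cong (λ x → suc (suc x)) (rank-suc-double a)

ω-suc-double : ∀ a → ω (suc (double a)) ≡ double a
ω-suc-double zero    = refl
ω-suc-double (suc a) = cong (λ x → suc (suc x)) (ω-suc-double a)

rank<double : ∀ {p} b → p < double b → rank p < double b
rank<double {0} (suc b) _ = s≤s (s≤s z≤n)
rank<double {1} (suc b) _ = s≤s z≤n
rank<double {suc (suc p)} (suc b) (s≤s (s≤s h)) = s≤s (s≤s (rank<double b h))

rank≢double : ∀ {p} b → p ≢ suc (double b) → rank p ≢ double b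
rank≢double b p≢ eq = p≢ (rank-injective (trans eq (sym (rank-suc-double b))))

rank≢suc-double : ∀ {p} b → p ≢ double b → rank p ≢ suc (double b)
rank≢suc-double b p≢ eq = p≢ (rank-injective (trans eq (sym (rank-double b))))

1≤rank : ∀ {p} → p ≢ 1 → 1 ≤ rank p
1≤rank p≢1 = n≢0⇒n>0 (λ eq → p≢1 (rank-injective eq))

ω≢1 : ∀ p → ω p ≢ 1
ω≢1 (suc (suc p)) ()

2≤ω : ∀ p → p ≢ 1 → 2 ≤ ω p
2≤ω 0 _ = s≤s (s≤s z≤n)
2≤ω 1 p≢1 = ⊥-elim (p≢1 refl)
2≤ω (suc (suc p)) _ = s≤s (s≤s z≤n)

ω<double : ∀ {p} b → p < double b → ω p ≤ suc (double b)
ω<double {0} (suc b) _ = s≤s (s≤s (s≤s z≤n))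
ω<double {1} (suc b) _ = z≤n
ω<double {suc (suc p)} (suc b) (s≤s (s≤s h)) = s≤s (s≤s (ω<double b h))

ω≢double : ∀ {p} b → p < double b → ω p ≢ double b
ω≢double {0} (suc (suc b)) _ ()
ω≢double {suc (suc p)} (suc b) (s≤s (s≤s h)) eq = ω≢double b h (suc-injective (suc-injective eq))

Inverted : Parity → (ℕ → ℕ) → ℕ → ℕ → Set
Inverted 0ℙ V i j = j < i × V i < V j
Inverted 1ℙ V i j = i < j × V j < V i

Ascending : (ℕ → ℕ) → ℕ → ℕ → Set
Ascending V i j = i < j × V i < V j

Inverted-irreflexive : ∀ b V i → ¬ Inverted b V i i
Inverted-irreflexive 0ℙ V i (i<i , _) = <-irrefl refl i<i
Inverted-irreflexive 1ℙ V i (i<i , _) = <-irrefl refl i<i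

Inverted⇒¬Ascending : ∀ b {V i j} → Inverted b V i j → ¬ Ascending V i j
Inverted⇒¬Ascending 0ℙ (j<i , _) (i<j , _) = <-asym j<i i<j
Inverted⇒¬Ascending 1ℙ (_ , v) (_ , v′) = <-asym v v′

Inverted⇒¬Ascending′ : ∀ b {V i j} → Inverted b V i j → ¬ Ascending V j i
Inverted⇒¬Ascending′ 0ℙ (_ , v) (_ , v′) = <-asym v v′
Inverted⇒¬Ascending′ 1ℙ (i<j , _) (j<i , _) = <-asym i<j j<i

Inverted-unique : ∀ b b′ {V i j} → Inverted b V i j → Inverted b′ V i j → b ≡ b′
Inverted-unique 0ℙ 0ℙ _ _ = refl
Inverted-unique 1ℙ 1ℙ _ _ = refl
Inverted-unique 0ℙ 1ℙ (j<i , _) (i<j , _) = ⊥-elim (<-asym j<i i<j)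
Inverted-unique 1ℙ 0ℙ (i<j , _) (j<i , _) = ⊥-elim (<-asym j<i i<j)

Inverted-suc² : ∀ b {p p′} → Inverted b ω p p′ → Inverted b ω (suc (suc p)) (suc (suc p′))
Inverted-suc² 0ℙ (p′<p , v) = s≤s (s≤s p′<p) , s≤s (s≤s v)
Inverted-suc² 1ℙ (p<p′ , v) = s≤s (s≤s p<p′) , s≤s (s≤s v)

rank-adjacent⇒inverted : ∀ p p′ → suc (rank p) ≡ rank p′ → Inverted (parity (rank p)) ω p p′
rank-adjacent⇒inverted 0 (suc (suc 1)) refl = s≤s z≤n , s≤s (s≤s (s≤s z≤n))
rank-adjacent⇒inverted 0 (suc (suc (suc (suc p′)))) ()
rank-adjacent⇒inverted 1 0 refl = s≤s z≤n , s≤s z≤n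
rank-adjacent⇒inverted 1 (suc (suc p′)) ()
rank-adjacent⇒inverted (suc (suc p)) (suc (suc p′)) eq =
  Inverted-suc² (parity (rank p)) (rank-adjacent⇒inverted p p′ (suc-injective (suc-injective eq)))

rank-distant⇒ascending : ∀ p p′ → 2 + rank p ≤ rank p′ → Ascending ω p p′
rank-distant⇒ascending p 0 (s≤s ())
rank-distant⇒ascending 0 (suc (suc 0)) _ = s≤s z≤n , s≤s (s≤s (s≤s (s≤s z≤n)))
rank-distant⇒ascending 0 (suc (suc 1)) (s≤s (s≤s ()))
rank-distant⇒ascending 0 (suc (suc (suc (suc p′)))) _ = s≤s z≤n , s≤s (s≤s (s≤s (s≤s z≤n)))
rank-distant⇒ascending 1 (suc (suc p′)) _ = s≤s (s≤s z≤n) , s≤s z≤n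
rank-distant⇒ascending (suc (suc p)) (suc (suc p′)) (s≤s (s≤s h))
  with rank-distant⇒ascending p p′ h
... | p<p′ , v = s≤s (s≤s p<p′) , s≤s (s≤s v)

-- The entry at a 0-based index, and 0 past the end.
entry : List ℕ → ℕ → ℕ
entry []       _       = 0
entry (x ∷ xs) zero    = x
entry (x ∷ xs) (suc i) = entry xs i

entry-applyUpTo : ∀ (f : ℕ → ℕ) {n i} → i < n → entry (applyUpTo f n) i ≡ f i
entry-applyUpTo f {suc n} {zero}  _       = refl
entry-applyUpTo f {suc n} {suc i} (s≤s h) = entry-applyUpTo (λ j → f (suc j)) h

applyUpTo-cong : ∀ {f g : ℕ → ℕ} n → (∀ i → i < n → f i ≡ g i) → applyUpTo f n ≡ applyUpTo g n
applyUpTo-cong zero    _  = refl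
applyUpTo-cong (suc n) eq = cong₂ _∷_ (eq 0 (s≤s z≤n)) (applyUpTo-cong n (λ i h → eq (suc i) (s≤s h)))

map-applyUpTo-≗ : ∀ (h f : ℕ → ℕ) {g : ℕ → ℕ} L → (∀ i → i < L → h (f i) ≡ g i) →
  map h (applyUpTo f L) ≡ applyUpTo g L
map-applyUpTo-≗ h f L eq = trans (map-applyUpTo f h L) (applyUpTo-cong L eq)

entry-++ˡ : ∀ (xs ys : List ℕ) {i} → i < length xs → entry (xs ++ ys) i ≡ entry xs i
entry-++ˡ (x ∷ xs) ys {zero}  _       = refl
entry-++ˡ (x ∷ xs) ys {suc i} (s≤s h) = entry-++ˡ xs ys h

entry-++ʳ : ∀ (xs ys : List ℕ) i → entry (xs ++ ys) (length xs + i) ≡ entry ys i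
entry-++ʳ []       ys i = refl
entry-++ʳ (x ∷ xs) ys i = entry-++ʳ xs ys i

entry-map : ∀ (f : ℕ → ℕ) (xs : List ℕ) {i} → i < length xs → entry (map f xs) i ≡ f (entry xs i)
entry-map f (x ∷ xs) {zero}  _       = refl
entry-map f (x ∷ xs) {suc i} (s≤s h) = entry-map f xs h

≡ᵇ-refl : ∀ m → (m ≡ᵇ m) ≡ true
≡ᵇ-refl zero    = refl
≡ᵇ-refl (suc m) = ≡ᵇ-refl m

≢⇒≡ᵇ-false : ∀ {x m} → x ≢ m → (x ≡ᵇ m) ≡ false
≢⇒≡ᵇ-false {zero}  {zero}  x≢m = ⊥-elim (x≢m refl)
≢⇒≡ᵇ-false {zero}  {suc m} _   = refl
≢⇒≡ᵇ-false {suc x} {zero}  _   = refl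
≢⇒≡ᵇ-false {suc x} {suc m} x≢m = ≢⇒≡ᵇ-false (λ eq → x≢m (cong suc eq))

swapVal-left : ∀ m → swapVal m m ≡ suc m
swapVal-left m rewrite ≡ᵇ-refl m = refl

swapVal-right : ∀ m → swapVal m (suc m) ≡ m
swapVal-right m rewrite ≢⇒≡ᵇ-false (λ eq → <⇒≢ (n<1+n m) (sym eq)) | ≡ᵇ-refl m = refl

swapVal-other : ∀ {m x} → x ≢ m → x ≢ suc m → swapVal m x ≡ x
swapVal-other x≢m x≢1+m rewrite ≢⇒≡ᵇ-false x≢m | ≢⇒≡ᵇ-false x≢1+m = refl

clamp : ℕ → ℕ → ℕ
clamp L x = 1 ⊔ (x ⊓ L)

swapVal-⊓ : ∀ {M x} → x ≢ M → x ≤ suc M → swapVal M (x ⊓ M) ≡ x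
swapVal-⊓ {M} {x} x≢M x≤1+M with m≤n⇒m<n∨m≡n x≤1+M
... | inj₁ (s≤s x≤M) with x<M ← ≤∧≢⇒< x≤M x≢M rewrite m≤n⇒m⊓n≡m x≤M =
  swapVal-other x≢M (<⇒≢ (m<n⇒m<1+n x<M))
... | inj₂ refl rewrite m≥n⇒m⊓n≡n (n≤1+n M) = swapVal-left M

swapVal-clamp : ∀ {L x} → 2 ≤ L → x ≢ L → x ≤ suc L → swapVal L (clamp L x) ≡ 1 ⊔ x
swapVal-clamp {suc zero} (s≤s ())
swapVal-clamp {suc (suc L)} {zero} _ _ _ = swapVal-other {suc (suc L)} {1} (λ ()) (λ ())
swapVal-clamp {suc L} {suc x} _ = swapVal-⊓

swapVal-1-after : ∀ {y} → 2 ≤ y → swapVal 1 ((1 ⊔ y) + 1) ≡ suc y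
swapVal-1-after {suc zero} (s≤s ())
swapVal-1-after {suc (suc y)} _ rewrite +-comm y 1 = refl

1⊔-< : ∀ {x y} → 2 ≤ y → x < y → 1 ⊔ x < y
1⊔-< {zero}  2≤y _   = 2≤y
1⊔-< {suc x} _   x<y = x<y

1⊔-strict : ∀ {x y} → x < y → y ≢ 1 → 1 ⊔ x < 1 ⊔ y
1⊔-strict {x} {y} x<y y≢1 = subst (1 ⊔ x <_) (sym (m≤n⇒m⊔n≡n (≤-trans (s≤s z≤n) 2≤y))) (1⊔-< 2≤y x<y)
  where
    2≤y : 2 ≤ y
    2≤y = ≤∧≢⇒< (≤-trans (s≤s z≤n) x<y) (λ eq → y≢1 (sym eq))

⊓-strict : ∀ {M x y} → x < y → y ≤ suc M → x ≢ M → x ⊓ M < y ⊓ M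
⊓-strict {M} {x} {y} x<y y≤1+M x≢M with m≤n⇒m<n∨m≡n y≤1+M
... | inj₁ (s≤s y≤M) rewrite m≤n⇒m⊓n≡m y≤M | m≤n⇒m⊓n≡m (≤-trans (<⇒≤ x<y) y≤M) = x<y
... | inj₂ refl with x<M ← ≤∧≢⇒< (≤-pred x<y) x≢M
  rewrite m≥n⇒m⊓n≡n (n≤1+n M) | m≤n⇒m⊓n≡m (<⇒≤ x<M) = x<M

clamp-strict : ∀ {L x y} → 2 ≤ L → x < y → y ≢ 1 → y ≤ suc L → x ≢ L → clamp L x < clamp L y
clamp-strict {L} {x} {y} 2≤L x<y y≢1 y≤1+L x≢L = 1⊔-strict (⊓-strict x<y y≤1+L x≢L) y⊓L≢1
  where
    y⊓L≢1 : y ⊓ L ≢ 1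
    y⊓L≢1 eq with ⊓-sel y L
    ... | inj₁ y⊓L≡y = y≢1 (trans (sym y⊓L≡y) eq)
    ... | inj₂ y⊓L≡L = <⇒≢ 2≤L (sym (trans (sym y⊓L≡L) eq))

monotone-reflects-< : ∀ {m : ℕ → ℕ} → (∀ {x y} → x ≤ y → m x ≤ m y) → ∀ {x y} → m x < m y → x < y
monotone-reflects-< mono {x} {y} mx<my with x <? y
... | yes x<y = x<y
... | no  x≮y = ⊥-elim (<⇒≱ mx<my (mono (≮⇒≥ x≮y)))

-- avoiding L enumerates ℕ ∖ {L} increasingly; unavoiding L inverts it on ℕ ∖ {L}.
avoiding : ℕ → ℕ → ℕ
avoiding zero    i       = suc i
avoiding (suc L) zero    = zero
avoiding (suc L) (suc i) = suc (avoiding L i)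

avoiding-< : ∀ {L i} → i < L → avoiding L i ≡ i
avoiding-< {suc L} {zero}  _       = refl
avoiding-< {suc L} {suc i} (s≤s h) = cong suc (avoiding-< h)

avoiding-≥ : ∀ {L i} → L ≤ i → avoiding L i ≡ suc i
avoiding-≥ {zero}  _       = refl
avoiding-≥ {suc L} (s≤s h) = cong suc (avoiding-≥ h)

avoiding-mono : ∀ L {i j} → i < j → avoiding L i < avoiding L j
avoiding-mono zero    i<j             = s≤s i<j
avoiding-mono (suc L) {zero} {suc j} _ = s≤s z≤n
avoiding-mono (suc L) {suc i} {suc j} (s≤s i<j) = s≤s (avoiding-mono L i<j)

avoiding-≢ : ∀ L i → avoiding L i ≢ L
avoiding-≢ (suc L) (suc i) eq = avoiding-≢ L i (suc-injective eq)

avoiding-≤ : ∀ L i → avoiding L i ≤ suc i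
avoiding-≤ zero    i       = ≤-refl
avoiding-≤ (suc L) zero    = z≤n
avoiding-≤ (suc L) (suc i) = s≤s (avoiding-≤ L i)

avoiding-injective : ∀ L {i j} → avoiding L i ≡ avoiding L j → i ≡ j
avoiding-injective L {i} {j} eq with <-cmp i j
... | tri< i<j _ _ = ⊥-elim (<⇒≢ (avoiding-mono L i<j) eq)
... | tri≈ _ i≡j _ = i≡j
... | tri> _ _ j<i = ⊥-elim (<⇒≢ (avoiding-mono L j<i) (sym eq))

unavoiding : ℕ → ℕ → ℕ
unavoiding zero    p       = pred p
unavoiding (suc L) zero    = zero
unavoiding (suc L) (suc p) = suc (unavoiding L p)

avoiding-unavoiding : ∀ L {p} → p ≢ L → avoiding L (unavoiding L p) ≡ p
avoiding-unavoiding zero    {zero}  p≢L = ⊥-elim (p≢L refl)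
avoiding-unavoiding zero    {suc p} _   = refl
avoiding-unavoiding (suc L) {zero}  _   = refl
avoiding-unavoiding (suc L) {suc p} p≢L = cong suc (avoiding-unavoiding L (λ eq → p≢L (cong suc eq)))

unavoiding-≤ : ∀ {M L p} → M ≤ L → p ≤ suc L → unavoiding M p ≤ L
unavoiding-≤ {zero}  _         p≤1+L       = pred-mono-≤ p≤1+L
unavoiding-≤ {suc M} {p = zero} _          _ = z≤n
unavoiding-≤ {suc M} {suc L} {suc p} (s≤s M≤L) (s≤s p≤1+L) = s≤s (unavoiding-≤ M≤L p≤1+L)

-- Increasing oscillations as windows of ω

applyUpTo-⊙1 : ∀ (f : ℕ → ℕ) {g : ℕ → ℕ} L →
  (∀ i → i < L → swapVal L (f i) ≡ g i) → swapVal L (suc L) ≡ g L →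
  applyUpTo f L ⊙ p1 ≡ applyUpTo g (suc L)
applyUpTo-⊙1 f {g} L inner last = begin
  applyUpTo f L ⊙ p1
    ≡⟨ cong (λ m → map (swapVal m) (applyUpTo f L ++ [ suc m ])) (length-applyUpTo f L) ⟩
  map (swapVal L) (applyUpTo f L ++ [ suc L ])
    ≡⟨ map-++ (swapVal L) (applyUpTo f L) [ suc L ] ⟩
  map (swapVal L) (applyUpTo f L) ++ [ swapVal L (suc L) ]
    ≡⟨ cong₂ _++_ (map-applyUpTo-≗ (swapVal L) f L inner) (cong [_] last) ⟩
  applyUpTo g L ++ [ g L ]
    ≡⟨ applyUpTo-∷ʳ g L ⟩
  applyUpTo g (suc L) ∎
  where open ≡-Reasoning

1⊙-applyUpTo : ∀ (f : ℕ → ℕ) {g : ℕ → ℕ} L →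
  g 0 ≡ 2 → (∀ i → i < L → swapVal 1 (f i + 1) ≡ g (suc i)) →
  p1 ⊙ applyUpTo f L ≡ applyUpTo g (suc L)
1⊙-applyUpTo f L first rest =
  cong₂ _∷_ (sym first)
    (trans (cong (map (swapVal 1)) (map-applyUpTo f (λ x → x + 1) L))
           (map-applyUpTo-≗ (swapVal 1) (λ i → f i + 1) L rest))

clamp-shift : ∀ k i → i < double (suc k) →
  swapVal 2 (clamp (double (suc k)) (ω i) + 2) ≡ clamp (double (suc (suc k))) (ω (suc (suc i)))
clamp-shift zero    zero          _ = refl
clamp-shift (suc k) zero          _ = refl
clamp-shift k       (suc zero)    _ = refl
clamp-shift k       (suc (suc i)) _ rewrite +-comm (ω i ⊓ double k) 2 = refl

-- On its first 2k positions ω takes the values 0, 2, 3, …, 2k − 1, 2k + 1, which clamp to 1, …, 2k.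
odot21-formula : ∀ k → odot21 (suc k) ≡ applyUpTo (λ i → clamp (double (suc k)) (ω i)) (double (suc k))
odot21-formula zero    = refl
odot21-formula (suc k) = cong (λ xs → 3 ∷ 1 ∷ xs) (begin
  map (swapVal 2) (map (λ x → x + 2) (odot21 (suc k)))
    ≡⟨ cong (λ xs → map (swapVal 2) (map (λ x → x + 2) xs)) (odot21-formula k) ⟩
  map (swapVal 2) (map (λ x → x + 2) (applyUpTo f L))
    ≡⟨ cong (map (swapVal 2)) (map-applyUpTo f (λ x → x + 2) L) ⟩
  map (swapVal 2) (applyUpTo (λ i → f i + 2) L)
    ≡⟨ map-applyUpTo-≗ (swapVal 2) (λ i → f i + 2) L (clamp-shift k) ⟩
  applyUpTo (λ i → clamp (double (suc (suc k))) (ω (suc (suc i)))) L ∎)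
  where
    open ≡-Reasoning
    L : ℕ
    L = double (suc k)
    f : ℕ → ℕ
    f i = clamp L (ω i)

odot21⊙1-formula : ∀ k → odot21 (suc k) ⊙ p1 ≡
  applyUpTo (λ i → 1 ⊔ ω (avoiding (double (suc k)) i)) (suc (double (suc k)))
odot21⊙1-formula k =
  trans (cong (_⊙ p1) (odot21-formula k)) (applyUpTo-⊙1 (λ i → clamp L (ω i)) L inner last)
  where
    L : ℕ
    L = double (suc k)
    inner : ∀ i → i < L → swapVal L (clamp L (ω i)) ≡ 1 ⊔ ω (avoiding L i)
    inner i i<L rewrite avoiding-< i<L =
      swapVal-clamp (s≤s (s≤s z≤n)) (ω≢double (suc k) i<L) (ω<double (suc k) i<L)
    last : swapVal L (suc L) ≡ 1 ⊔ ω (avoiding L L)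
    last = trans (swapVal-right L)
      (cong (1 ⊔_) (sym (trans (cong ω (avoiding-≥ (≤-refl {L}))) (ω-suc-double (suc k)))))

1⊙odot21-formula : ∀ k → p1 ⊙ odot21 (suc k) ≡
  applyUpTo (λ i → (ω (avoiding 1 i) ∸ 1) ⊓ suc (double (suc k))) (suc (double (suc k)))
1⊙odot21-formula k =
  trans (cong (p1 ⊙_) (odot21-formula k))
        (1⊙-applyUpTo (λ i → clamp L (ω i)) {λ i → (ω (avoiding 1 i) ∸ 1) ⊓ suc L} L refl shifted)
  where
    L : ℕ
    L = double (suc k)
    shifted : ∀ i → i < L → swapVal 1 (clamp L (ω i) + 1) ≡ suc (ω i ⊓ L)
    shifted i _ with i ≟ 1
    ... | yes refl = refl
    ... | no i≢1 = swapVal-1-after (⊓-glb (2≤ω i i≢1) (s≤s (s≤s z≤n)))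

avoiding1<double : ∀ k {i} → i < suc (double (suc k)) → avoiding 1 i < double (suc (suc k))
avoiding1<double k {i} i< = s≤s (≤-trans (avoiding-≤ 1 i) i<)

ω-avoiding1∸1≢ : ∀ k {i} → i < suc (double (suc k)) → ω (avoiding 1 i) ∸ 1 ≢ suc (double (suc k))
ω-avoiding1∸1≢ k {i} i< eq with ω (avoiding 1 i) in ωp
... | suc y = ω≢double (suc (suc k)) (avoiding1<double k i<) (trans ωp (cong suc eq))

2≤ω-avoiding1 : ∀ i → 2 ≤ ω (avoiding 1 i)
2≤ω-avoiding1 i = 2≤ω (avoiding 1 i) (avoiding-≢ 1 i)

1⊙odot21⊙1-formula : ∀ k → p1 ⊙ odot21 (suc k) ⊙ p1 ≡
  applyUpTo (λ i → ω (avoiding 1 (avoiding (suc (double (suc k))) i)) ∸ 1) (suc (suc (double (suc k))))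
1⊙odot21⊙1-formula k =
  trans (cong (_⊙ p1) (1⊙odot21-formula k))
        (applyUpTo-⊙1 (λ i → (ω (avoiding 1 i) ∸ 1) ⊓ suc L) (suc L) inner last)
  where
    L : ℕ
    L = double (suc k)
    inner : ∀ i → i < suc L → swapVal (suc L) ((ω (avoiding 1 i) ∸ 1) ⊓ suc L) ≡
                                ω (avoiding 1 (avoiding (suc L) i)) ∸ 1
    inner i i<1+L rewrite avoiding-< i<1+L =
      swapVal-⊓ (ω-avoiding1∸1≢ k i<1+L) (∸-monoˡ-≤ 1 (ω<double (suc (suc k)) (avoiding1<double k i<1+L)))
    last : swapVal (suc L) (suc (suc L)) ≡ ω (avoiding 1 (avoiding (suc L) (suc L))) ∸ 1
    last = trans (swapVal-right (suc L))
      (sym (trans (cong (λ p → ω (avoiding 1 p) ∸ 1) (avoiding-≥ (≤-refl {suc L})))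
                  (cong (_∸ 1) (ω-suc-double (suc (suc k))))))

-- Window π start size: π is order-isomorphic to ω restricted to the positions
-- pos 0 < pos 1 < … < pos (size − 1), whose ranks are exactly start, …, start + size − 1.
record Window (π : List ℕ) (start size : ℕ) : Set where
  field
    length≡     : length π ≡ size
    pos         : ℕ → ℕ
    pos-mono    : ∀ {i j} → i < j → j < size → pos i < pos j
    ω-order→    : ∀ {i j} → i < size → j < size → entry π i < entry π j → ω (pos i) < ω (pos j)
    ω-order←    : ∀ {i j} → i < size → j < size → ω (pos i) < ω (pos j) → entry π i < entry π j
    rank-range  : ∀ {i} → i < size → start ≤ rank (pos i) × rank (pos i) < start + size
    index       : ℕ → ℕ
    index-spec  : ∀ {t} → start ≤ t → t < start + size → index t < size × rank (pos (index t)) ≡ t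
    entry-range : ∀ {i} → i < size → 1 ≤ entry π i × entry π i ≤ size

applyUpTo-window : ∀ {π start size} (m pos : ℕ → ℕ) →
  π ≡ applyUpTo (λ i → m (ω (pos i))) size →
  (∀ {x y} → x ≤ y → m x ≤ m y) →
  (∀ {i j} → i < size → j < size → ω (pos i) < ω (pos j) → m (ω (pos i)) < m (ω (pos j))) →
  (∀ {i j} → i < j → j < size → pos i < pos j) →
  (∀ {i} → i < size → start ≤ rank (pos i) × rank (pos i) < start + size) →
  (index : ℕ → ℕ) →
  (∀ {t} → start ≤ t → t < start + size → index t < size × rank (pos (index t)) ≡ t) →
  (∀ {i} → i < size → 1 ≤ m (ω (pos i)) × m (ω (pos i)) ≤ size) →
  Window π start size
applyUpTo-window {π} {start} {size} m pos π≡ mono strict pos-mono range index index-spec bounds = record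
  { length≡     = trans (cong length π≡) (length-applyUpTo _ size)
  ; pos         = pos
  ; pos-mono    = pos-mono
  ; ω-order→    = λ i< j< lt → monotone-reflects-< mono (subst₂ _<_ (entry≡ i<) (entry≡ j<) lt)
  ; ω-order←    = λ i< j< lt → subst₂ _<_ (sym (entry≡ i<)) (sym (entry≡ j<)) (strict i< j< lt)
  ; rank-range  = range
  ; index       = index
  ; index-spec  = index-spec
  ; entry-range = λ i< → subst (1 ≤_) (sym (entry≡ i<)) (proj₁ (bounds i<)) ,
                         subst (_≤ size) (sym (entry≡ i<)) (proj₂ (bounds i<))
  }
  where
    entry≡ : ∀ {i} → i < size → entry π i ≡ m (ω (pos i))
    entry≡ i< = trans (cong (λ xs → entry xs _) π≡) (entry-applyUpTo _ i<)

odot21-window : ∀ k → Window (odot21 (suc k)) 0 (double (suc k))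
odot21-window k = applyUpTo-window (clamp L) (λ i → i) (odot21-formula k)
  (λ x≤y → ⊔-monoʳ-≤ 1 (⊓-monoˡ-≤ L x≤y))
  (λ {i} {j} i<L j<L lt →
     clamp-strict (s≤s (s≤s z≤n)) lt (ω≢1 j) (ω<double (suc k) j<L) (ω≢double (suc k) i<L))
  (λ i<j _ → i<j)
  (λ i<L → z≤n , rank<double (suc k) i<L)
  rank
  (λ {t} _ t<L → rank<double (suc k) t<L , rank-involutive t)
  (λ {i} _ → m≤m⊔n 1 (ω i ⊓ L) , ⊔-lub (s≤s z≤n) (m⊓n≤n (ω i) L))
  where
    L : ℕ
    L = double (suc k)

odot21⊙1-window : ∀ k → Window (odot21 (suc k) ⊙ p1) 0 (suc (double (suc k)))
odot21⊙1-window k = applyUpTo-window (1 ⊔_) (avoiding L) (odot21⊙1-formula k)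
  (⊔-monoʳ-≤ 1)
  (λ {i} {j} _ _ lt → 1⊔-strict lt (ω≢1 (avoiding L j)))
  (λ i<j _ → avoiding-mono L i<j)
  (λ {i} i≤L → z≤n , ≤∧≢⇒< (≤-pred (rank<double (suc (suc k)) (avoiding< i≤L)))
                            (rank≢suc-double (suc k) (avoiding-≢ L i)))
  (λ t → unavoiding L (rank t))
  (λ {t} _ t≤L → let rank≢L = rank≢double (suc k) (<⇒≢ t≤L) in
    s≤s (unavoiding-≤ ≤-refl (≤-pred (rank<double (suc (suc k)) (≤-trans t≤L (n≤1+n _))))) ,
    trans (cong rank (avoiding-unavoiding L rank≢L)) (rank-involutive t))
  (λ {i} i≤L → m≤m⊔n 1 (ω (avoiding L i)) , ⊔-lub (s≤s z≤n) (ω-bound i≤L))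
  where
    L : ℕ
    L = double (suc k)
    avoiding< : ∀ {i} → i < suc L → avoiding L i < double (suc (suc k))
    avoiding< {i} i≤L = s≤s (≤-trans (avoiding-≤ L i) i≤L)
    ω-bound : ∀ {i} → i < suc L → ω (avoiding L i) ≤ suc L
    ω-bound {i} (s≤s i≤L) with m≤n⇒m<n∨m≡n i≤L
    ... | inj₁ i<L rewrite avoiding-< i<L = ω<double (suc k) i<L
    ... | inj₂ refl =
      ≤-trans (≤-reflexive (trans (cong ω (avoiding-≥ (≤-refl {L}))) (ω-suc-double (suc k)))) (n≤1+n L)

1⊙odot21-window : ∀ k → Window (p1 ⊙ odot21 (suc k)) 1 (suc (double (suc k)))
1⊙odot21-window k = applyUpTo-window (λ x → (x ∸ 1) ⊓ suc L) (avoiding 1) (1⊙odot21-formula k)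
  (λ x≤y → ⊓-monoˡ-≤ (suc L) (∸-monoˡ-≤ 1 x≤y))
  (λ {i} {j} i< j< lt → ⊓-strict (∸-monoˡ-< lt (≤-trans (s≤s z≤n) (2≤ω-avoiding1 i)))
                          (∸-monoˡ-≤ 1 (ω<double (suc (suc k)) (avoiding1<double k j<)))
                          (ω-avoiding1∸1≢ k i<))
  (λ i<j _ → avoiding-mono 1 i<j)
  (λ {i} i< → 1≤rank (avoiding-≢ 1 i) , rank<double (suc (suc k)) (avoiding1<double k i<))
  (λ t → unavoiding 1 (rank t))
  (λ {t} 1≤t t< → let rank≢1 = λ eq → <⇒≢ 1≤t (sym (rank-injective eq)) in
    s≤s (unavoiding-≤ (s≤s z≤n) (≤-pred (rank<double (suc (suc k)) t<))) ,
    trans (cong rank (avoiding-unavoiding 1 rank≢1)) (rank-involutive t))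
  (λ {i} _ → ⊓-glb (∸-monoˡ-≤ 1 (2≤ω-avoiding1 i)) (s≤s z≤n) , m⊓n≤n _ (suc L))
  where
    L : ℕ
    L = double (suc k)

1⊙odot21⊙1-window : ∀ k → Window (p1 ⊙ odot21 (suc k) ⊙ p1) 1 (suc (suc (double (suc k))))
1⊙odot21⊙1-window k = applyUpTo-window (_∸ 1) pos (1⊙odot21⊙1-formula k)
  (∸-monoˡ-≤ 1)
  (λ {i} _ _ lt → ∸-monoˡ-< lt (≤-trans (s≤s z≤n) (2≤ω-avoiding1 (avoiding (suc L) i))))
  (λ i<j _ → avoiding-mono 1 (avoiding-mono (suc L) i<j))
  (λ {i} i< → 1≤rank (avoiding-≢ 1 (avoiding (suc L) i)) , rank-bound i<)
  (λ t → unavoiding (suc L) (unavoiding 1 (rank t)))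
  index-spec
  (λ {i} i< → ∸-monoˡ-≤ 1 (2≤ω-avoiding1 (avoiding (suc L) i)) , ω-bound i<)
  where
    L : ℕ
    L = double (suc k)
    pos : ℕ → ℕ
    pos i = avoiding 1 (avoiding (suc L) i)
    rank-bound : ∀ {i} → i < suc (suc L) → rank (pos i) < suc (suc (suc L))
    rank-bound {i} i< =
      ≤∧≢⇒< (≤-pred (rank<double (suc (suc (suc k))) pos<)) (rank≢suc-double (suc (suc k)) pos≢)
      where
        pos< : pos i < double (suc (suc (suc k)))
        pos< = s≤s (≤-trans (avoiding-≤ 1 _) (s≤s (≤-trans (avoiding-≤ (suc L) i) i<)))
        pos≢ : pos i ≢ double (suc (suc k))
        pos≢ eq = avoiding-≢ (suc L) i (avoiding-injective 1 eq)
    index-spec : ∀ {t} → 1 ≤ t → t < 1 + suc (suc L) →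
      unavoiding (suc L) (unavoiding 1 (rank t)) < suc (suc L) ×
      rank (pos (unavoiding (suc L) (unavoiding 1 (rank t)))) ≡ t
    index-spec {t} 1≤t t< = s≤s (unavoiding-≤ ≤-refl u≤) , (begin
      rank (pos (unavoiding (suc L) u)) ≡⟨ cong (λ v → rank (avoiding 1 v)) (avoiding-unavoiding (suc L) u≢) ⟩
      rank (avoiding 1 u)                ≡⟨ cong rank avoiding-u ⟩
      rank (rank t)                      ≡⟨ rank-involutive t ⟩
      t                                  ∎)
      where
        open ≡-Reasoning
        u : ℕ
        u = unavoiding 1 (rank t)
        avoiding-u : avoiding 1 u ≡ rank t
        avoiding-u = avoiding-unavoiding 1 (λ eq → <⇒≢ 1≤t (sym (rank-injective eq)))
        u≤ : u ≤ suc (suc L)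
        u≤ = unavoiding-≤ (s≤s z≤n) (≤-pred (rank<double (suc (suc (suc k))) (m<n⇒m<1+n t<)))
        u≢ : u ≢ suc L
        u≢ eq = rank≢double (suc (suc k)) (<⇒≢ t<) (trans (sym avoiding-u) (cong (avoiding 1) eq))
    ω-bound : ∀ {i} → i < suc (suc L) → ω (pos i) ∸ 1 ≤ suc (suc L)
    ω-bound {i} (s≤s i≤1+L) with m≤n⇒m<n∨m≡n i≤1+L
    ... | inj₁ i<1+L rewrite avoiding-< i<1+L =
      ∸-monoˡ-≤ 1 (ω<double (suc (suc k)) (avoiding1<double k i<1+L))
    ... | inj₂ refl = ≤-trans (≤-reflexive (cong (_∸ 1) ω-last)) (n≤1+n _)
      where
        ω-last : ω (pos (suc L)) ≡ suc (suc L)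
        ω-last = trans (cong (λ v → ω (avoiding 1 v)) (avoiding-≥ (≤-refl {suc L}))) (ω-suc-double (suc (suc k)))

module WindowProperties {π start size} (W : Window π start size) where
  open Window W public

  val : ℕ → ℕ
  val i = ω (pos i)

  rankAt : ℕ → ℕ
  rankAt i = rank (pos i)

  entry-range-length : ∀ {i} → i < length π → 1 ≤ entry π i × entry π i ≤ length π
  entry-range-length {i} i< = subst (λ m → 1 ≤ entry π i × entry π i ≤ m) (sym length≡)
                                    (entry-range (subst (i <_) length≡ i<))

  pos-reflects-< : ∀ {i j} → i < size → j < size → pos i < pos j → i < j
  pos-reflects-< {i} {j} i< j< lt with <-cmp i j
  ... | tri< i<j _ _ = i<j
  ... | tri≈ _ refl _ = ⊥-elim (<-irrefl refl lt)
  ... | tri> _ _ j<i = ⊥-elim (<-asym lt (pos-mono j<i i<))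

  rankAt-injective : ∀ {i j} → i < size → j < size → rankAt i ≡ rankAt j → i ≡ j
  rankAt-injective {i} {j} i< j< eq with <-cmp i j
  ... | tri< i<j _ _ = ⊥-elim (<⇒≢ (pos-mono i<j j<) (rank-injective eq))
  ... | tri≈ _ i≡j _ = i≡j
  ... | tri> _ _ j<i = ⊥-elim (<⇒≢ (pos-mono j<i i<) (sym (rank-injective eq)))

  adjacent⇒inverted : ∀ {i j} → i < size → j < size → suc (rankAt i) ≡ rankAt j →
    Inverted (parity (rankAt i)) val i j
  adjacent⇒inverted i< j< adj = pull (parity (rankAt _)) (rank-adjacent⇒inverted _ _ adj)
    where
      pull : ∀ b → Inverted b ω (pos _) (pos _) → Inverted b val _ _
      pull 0ℙ (pj<pi , v) = pos-reflects-< j< i< pj<pi , v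
      pull 1ℙ (pi<pj , v) = pos-reflects-< i< j< pi<pj , v

  distant⇒ascending : ∀ {i j} → i < size → j < size → 2 + rankAt i ≤ rankAt j → Ascending val i j
  distant⇒ascending i< j< far with rank-distant⇒ascending _ _ far
  ... | pi<pj , v = pos-reflects-< i< j< pi<pj , v

  inverted⇒adjacent : ∀ b {i j} → i < size → j < size → Inverted b val i j →
    suc (rankAt i) ≡ rankAt j ⊎ suc (rankAt j) ≡ rankAt i
  inverted⇒adjacent b {i} {j} i< j< inv with <-cmp (rankAt i) (rankAt j)
  ... | tri≈ _ eq _ with refl ← rankAt-injective i< j< eq = ⊥-elim (Inverted-irreflexive b val i inv)
  inverted⇒adjacent b {i} {j} i< j< inv | tri< lt _ _ with m≤n⇒m<n∨m≡n lt
  ... | inj₂ adj = inj₁ adj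
  ... | inj₁ far = ⊥-elim (Inverted⇒¬Ascending b inv (distant⇒ascending i< j< far))
  inverted⇒adjacent b {i} {j} i< j< inv | tri> _ _ gt with m≤n⇒m<n∨m≡n gt
  ... | inj₂ adj = inj₂ adj
  ... | inj₁ far = ⊥-elim (Inverted⇒¬Ascending′ b inv (distant⇒ascending j< i< far))

  ascending⇒distant : ∀ {i j} → i < size → j < size → Ascending val i j → 2 + rankAt i ≤ rankAt j
  ascending⇒distant {i} {j} i< j< asc with <-cmp (rankAt i) (rankAt j)
  ... | tri≈ _ eq _ with refl ← rankAt-injective i< j< eq = ⊥-elim (<-irrefl refl (proj₁ asc))
  ascending⇒distant {i} {j} i< j< asc | tri< lt _ _ with m≤n⇒m<n∨m≡n lt
  ... | inj₁ far = far
  ... | inj₂ adj = ⊥-elim (Inverted⇒¬Ascending _ (adjacent⇒inverted i< j< adj) asc)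
  ascending⇒distant {i} {j} i< j< asc | tri> _ _ gt with m≤n⇒m<n∨m≡n gt
  ... | inj₁ far = ⊥-elim (<-asym (proj₁ asc) (proj₁ (distant⇒ascending j< i< far)))
  ... | inj₂ adj = ⊥-elim (Inverted⇒¬Ascending′ _ (adjacent⇒inverted j< i< adj) asc)

  inverted-parity : ∀ b {i j} → i < size → j < size → Inverted b val i j → suc (rankAt i) ≡ rankAt j →
    parity (rankAt i) ≡ b
  inverted-parity b i< j< inv adj = Inverted-unique _ b (adjacent⇒inverted i< j< adj) inv

-- Occurrences

record IsOccurrence (σ π : List ℕ) (f : ℕ → ℕ) : Set where
  field
    f<     : ∀ {i} → i < length σ → f i < length π
    f-mono : ∀ {i j} → i < j → j < length σ → f i < f j
    order→ : ∀ {i j} → i < length σ → j < length σ → entry σ i < entry σ j → entry π (f i) < entry π (f j)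
    order← : ∀ {i j} → i < length σ → j < length σ → entry π (f i) < entry π (f j) → entry σ i < entry σ j

Occurrence : List ℕ → List ℕ → Set
Occurrence σ π = Σ (ℕ → ℕ) (IsOccurrence σ π)

lookup≡entry : ∀ (xs : List ℕ) (k : Fin (length xs)) → lookup xs k ≡ entry xs (toℕ k)
lookup≡entry (x ∷ xs) Fin.zero    = refl
lookup≡entry (x ∷ xs) (Fin.suc k) = lookup≡entry xs k

Sublist-indices : ∀ {τ π : List ℕ} → Sublist _≡_ τ π → Σ (ℕ → ℕ) λ h →
  (∀ i → i < length τ → h i < length π × entry τ i ≡ entry π (h i)) ×
  (∀ i j → i < j → j < length τ → h i < h j)
Sublist-indices [] = (λ i → i) , (λ _ ()) , (λ _ _ _ ())
Sublist-indices (y ∷ʳ s) with Sublist-indices s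
... | h , h-spec , h-mono =
  (λ i → suc (h i)) , (λ i i< → s≤s (proj₁ (h-spec i i<)) , proj₂ (h-spec i i<)) ,
  (λ i j i<j j< → s≤s (h-mono i j i<j j<))
Sublist-indices (refl ∷ s) with Sublist-indices s
... | h , h-spec , h-mono = h′ , h′-spec , h′-mono
  where
    h′ : ℕ → ℕ
    h′ zero    = zero
    h′ (suc i) = suc (h i)
    h′-spec : ∀ i → i < suc _ → h′ i < suc _ × _
    h′-spec zero    _        = s≤s z≤n , refl
    h′-spec (suc i) (s≤s i<) = s≤s (proj₁ (h-spec i i<)) , proj₂ (h-spec i i<)
    h′-mono : ∀ i j → i < j → j < suc _ → h′ i < h′ j
    h′-mono zero    (suc j) _         _        = s≤s z≤n
    h′-mono (suc i) (suc j) (s≤s i<j) (s≤s j<) = s≤s (h-mono i j i<j j<)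

OrderIso⇒entry-⇔ : ∀ {σ τ : List ℕ} → OrderIso σ τ → length σ ≡ length τ ×
  (∀ {i j} → i < length σ → j < length σ →
     (entry σ i < entry σ j → entry τ i < entry τ j) × (entry τ i < entry τ j → entry σ i < entry σ j))
OrderIso⇒entry-⇔ {σ} {τ} (len≡ , iso) = len≡ , λ i< j< →
  let σi = entry≡ σ i< ; σj = entry≡ σ j<
      τi = trans (cast-entry i<) (cong (entry τ) (toℕ-fromℕ< i<))
      τj = trans (cast-entry j<) (cong (entry τ) (toℕ-fromℕ< j<))
      E  = iso (fromℕ< i<) (fromℕ< j<)
  in (λ lt → subst₂ _<_ τi τj (Equivalence.to E (subst₂ _<_ (sym σi) (sym σj) lt))) ,
     (λ lt → subst₂ _<_ σi σj (Equivalence.from E (subst₂ _<_ (sym τi) (sym τj) lt)))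
  where
    entry≡ : ∀ (xs : List ℕ) {i} (i< : i < length xs) → lookup xs (fromℕ< i<) ≡ entry xs i
    entry≡ xs i< = trans (lookup≡entry xs (fromℕ< i<)) (cong (entry xs) (toℕ-fromℕ< i<))
    cast-entry : ∀ {i} (i< : i < length σ) → lookup τ (cast len≡ (fromℕ< i<)) ≡ entry τ (toℕ (fromℕ< i<))
    cast-entry i< = trans (lookup≡entry τ _) (cong (entry τ) (toℕ-cast len≡ (fromℕ< i<)))

≼⇒Occurrence : ∀ {σ π} → σ ≼ π → Occurrence σ π
≼⇒Occurrence {σ} {π} (τ , τ⊆π , σ≅τ) with Sublist-indices τ⊆π | OrderIso⇒entry-⇔ {σ} {τ} σ≅τ
... | h , h-spec , h-mono | len≡ , order = h , record
  { f<     = λ i< → proj₁ (h-spec _ (in-τ i<))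
  ; f-mono = λ i<j j< → h-mono _ _ i<j (in-τ j<)
  ; order→ = λ i< j< lt → subst₂ _<_ (proj₂ (h-spec _ (in-τ i<))) (proj₂ (h-spec _ (in-τ j<)))
                            (proj₁ (order i< j<) lt)
  ; order← = λ i< j< lt → proj₂ (order i< j<)
                (subst₂ _<_ (sym (proj₂ (h-spec _ (in-τ i<)))) (sym (proj₂ (h-spec _ (in-τ j<)))) lt)
  }
  where
    in-τ : ∀ {i} → i < length σ → i < length τ
    in-τ {i} = subst (i <_) len≡

length-sumPow : ∀ r α → length (sumPow r α) ≡ r * length α
length-sumPow zero    α = refl
length-sumPow (suc r) α = begin
  length (α ++ map (_+ length α) (sumPow r α))   ≡⟨ length-++ α ⟩
  length α + length (map (_+ length α) (sumPow r α)) ≡⟨ cong (length α +_) (length-map _ (sumPow r α)) ⟩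
  length α + length (sumPow r α)                 ≡⟨ cong (length α +_) (length-sumPow r α) ⟩
  length α + r * length α                        ∎
  where open ≡-Reasoning

block-index< : ∀ {c r j L} → c < r → j < L → c * L + j < r * L
block-index< {c} {r} {j} {L} c<r j<L = begin-strict
  c * L + j <⟨ +-monoʳ-< (c * L) j<L ⟩
  c * L + L ≡⟨ +-comm (c * L) L ⟩
  suc c * L ≤⟨ *-monoˡ-≤ L c<r ⟩
  r * L     ∎
  where open ≤-Reasoning

block-index<length : ∀ r α {c j} → c < r → j < length α → c * length α + j < length (sumPow r α)
block-index<length r α {c} {j} c<r j< =
  subst (c * length α + j <_) (sym (length-sumPow r α)) (block-index< c<r j<)

entry-sumPow : ∀ r α {c j} → c < r → j < length α →
  entry (sumPow r α) (c * length α + j) ≡ entry α j + c * length α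
entry-sumPow (suc r) α {zero}  {j} _         j< = trans (entry-++ˡ α _ j<) (sym (+-identityʳ _))
entry-sumPow (suc r) α {suc c} {j} (s≤s c<r) j< = begin
  entry (α ++ map (_+ L) (sumPow r α)) ((L + c * L) + j)
    ≡⟨ cong (entry (sumPow (suc r) α)) (+-assoc L (c * L) j) ⟩
  entry (α ++ map (_+ L) (sumPow r α)) (L + (c * L + j))
    ≡⟨ entry-++ʳ α _ (c * L + j) ⟩
  entry (map (_+ L) (sumPow r α)) (c * L + j)
    ≡⟨ entry-map (_+ L) (sumPow r α) (block-index<length r α c<r j<) ⟩
  entry (sumPow r α) (c * L + j) + L
    ≡⟨ cong (_+ L) (entry-sumPow r α c<r j<) ⟩
  (entry α j + c * L) + L
    ≡⟨ +-assoc (entry α j) (c * L) L ⟩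
  entry α j + (c * L + L)
    ≡⟨ cong (entry α j +_) (+-comm (c * L) L) ⟩
  entry α j + (L + c * L) ∎
  where
    open ≡-Reasoning
    L = length α

block : ℕ → (ℕ → ℕ) → ℕ → ℕ → ℕ
block L f c j = f (c * L + j)

module _ {α π : List ℕ} {r : ℕ} (o : Occurrence (sumPow r α) π) where
  open IsOccurrence (proj₂ o)
  private
    f = proj₁ o
    L = length α
    in-sum = block-index<length r α

  block-occurrence : ∀ {c} → c < r → IsOccurrence α π (block L f c)
  block-occurrence {c} c<r = record
    { f<     = λ j< → f< (in-sum c<r j<)
    ; f-mono = λ j<j′ j′< → f-mono (+-monoʳ-< (c * L) j<j′) (in-sum c<r j′<)
    ; order→ = λ j< j′< lt → order→ (in-sum c<r j<) (in-sum c<r j′<)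
        (subst₂ _<_ (sym (entry-sumPow r α c<r j<)) (sym (entry-sumPow r α c<r j′<)) (+-monoˡ-< (c * L) lt))
    ; order← = λ j< j′< lt → +-cancelʳ-< (c * L) _ _
        (subst₂ _<_ (entry-sumPow r α c<r j<) (entry-sumPow r α c<r j′<)
          (order← (in-sum c<r j<) (in-sum c<r j′<) lt))
    }

  blocks-ascending : (∀ {j} → j < L → 1 ≤ entry α j × entry α j ≤ L) →
    ∀ {c c′ j j′} → c < c′ → c′ < r → j < L → j′ < L →
    block L f c j < block L f c′ j′ × entry π (block L f c j) < entry π (block L f c′ j′)
  blocks-ascending range {c} {c′} {j} {j′} c<c′ c′<r j< j′< =
    f-mono index< (in-sum c′<r j′<) ,
    order→ (in-sum (<-trans c<c′ c′<r) j<) (in-sum c′<r j′<)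
      (subst₂ _<_ (sym (entry-sumPow r α (<-trans c<c′ c′<r) j<)) (sym (entry-sumPow r α c′<r j′<)) values<)
    where
      index< : c * L + j < c′ * L + j′
      index< = <-≤-trans (block-index< {c} {suc c} ≤-refl j<) (≤-trans (*-monoˡ-≤ L c<c′) (m≤m+n _ _))
      values< : entry α j + c * L < entry α j′ + c′ * L
      values< = begin-strict
        entry α j + c * L   ≤⟨ +-monoˡ-≤ (c * L) (proj₂ (range j<)) ⟩
        L + c * L           ≤⟨ *-monoˡ-≤ L c<c′ ⟩
        c′ * L              <⟨ +-monoˡ-≤ (c′ * L) (proj₁ (range j′<)) ⟩
        entry α j′ + c′ * L ∎
        where open ≤-Reasoning

unit-steps-climb : ∀ {a b c} → suc a ≡ b ⊎ suc b ≡ a → suc b ≡ c ⊎ suc c ≡ b → 2 + a ≤ c →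
  suc a ≡ b × suc b ≡ c
unit-steps-climb (inj₁ ab) (inj₁ bc) _ = ab , bc
unit-steps-climb (inj₁ refl) (inj₂ refl) a+2≤c = ⊥-elim (<-irrefl refl (≤-trans a+2≤c (n≤1+n _)))
unit-steps-climb (inj₂ refl) (inj₁ refl) a+2≤c = ⊥-elim (<-irrefl refl (≤-trans a+2≤c (n≤1+n _)))
unit-steps-climb (inj₂ refl) (inj₂ refl) a+2≤c =
  ⊥-elim (<-irrefl refl (≤-trans a+2≤c (≤-trans (n≤1+n _) (≤-trans (n≤1+n _) (n≤1+n _)))))

module OccurrenceRanks {α π : List ℕ} {Aα L Aπ N : ℕ}
                       (Wα : Window α Aα L) (Wπ : Window π Aπ N) (f : ℕ → ℕ) where
  private
    module A = WindowProperties Wα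
    module B = WindowProperties Wπ

  -- walk t is the entry of α of rank Aα + t, so image follows the inversion path of α inside π.
  walk : ℕ → ℕ
  walk t = A.index (Aα + t)

  image : ℕ → ℕ
  image t = B.rankAt (f (walk t))

  -- For L = 2 the single inversion of α may be traversed in either direction, hence the minimum.
  low : ℕ
  low = image 0 ⊓ image (L ∸ 1)

  module _ (occ : IsOccurrence α π f) where
    open IsOccurrence occ

    in-α : ∀ {j} → j < L → j < length α
    in-α {j} = subst (j <_) (sym A.length≡)

    in-π : ∀ {j} → j < L → f j < N
    in-π {j} j< = subst (f j <_) B.length≡ (f< (in-α j<))

    walk< : ∀ {t} → t < L → walk t < L
    walk< t< = proj₁ (A.index-spec (m≤m+n _ _) (+-monoʳ-< Aα t<))

    rankAt-walk : ∀ {t} → t < L → A.rankAt (walk t) ≡ Aα + t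
    rankAt-walk t< = proj₂ (A.index-spec (m≤m+n _ _) (+-monoʳ-< Aα t<))

    image-range : ∀ {t} → t < L → Aπ ≤ image t × image t < Aπ + N
    image-range t< = B.rank-range (in-π (walk< t<))

    val-transfer : ∀ {j j′} → j < L → j′ < L → A.val j < A.val j′ → B.val (f j) < B.val (f j′)
    val-transfer j< j′< lt =
      B.ω-order→ (in-π j<) (in-π j′<) (order→ (in-α j<) (in-α j′<) (A.ω-order← j< j′< lt))

    Inverted-transfer : ∀ b {j j′} → j < L → j′ < L → Inverted b A.val j j′ → Inverted b B.val (f j) (f j′)
    Inverted-transfer 0ℙ j< j′< (j′<j , v) = f-mono j′<j (in-α j<) , val-transfer j< j′< v
    Inverted-transfer 1ℙ j< j′< (j<j′ , v) = f-mono j<j′ (in-α j′<) , val-transfer j′< j< v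

    Ascending-transfer : ∀ {j j′} → j < L → j′ < L → Ascending A.val j j′ → Ascending B.val (f j) (f j′)
    Ascending-transfer j< j′< (j<j′ , v) = f-mono j<j′ (in-α j′<) , val-transfer j< j′< v

    walk-inverted : ∀ {t} → suc t < L → Inverted (parity (Aα + t)) B.val (f (walk t)) (f (walk (suc t)))
    walk-inverted {t} t+1< =
      Inverted-transfer _ (walk< t<) (walk< t+1<)
        (subst (λ x → Inverted (parity x) A.val (walk t) (walk (suc t))) (rankAt-walk t<)
          (A.adjacent⇒inverted (walk< t<) (walk< t+1<)
            (trans (cong suc (rankAt-walk t<)) (trans (sym (+-suc Aα t)) (sym (rankAt-walk t+1<))))))
      where
        t< = <-trans (n<1+n t) t+1<

    image-adjacent : ∀ {t} → suc t < L → suc (image t) ≡ image (suc t) ⊎ suc (image (suc t)) ≡ image t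
    image-adjacent {t} t+1< =
      B.inverted⇒adjacent _ (in-π (walk< (<-trans (n<1+n t) t+1<))) (in-π (walk< t+1<)) (walk-inverted t+1<)

    image-distant : ∀ {t} → suc (suc t) < L → 2 + image t ≤ image (suc (suc t))
    image-distant {t} t+2< =
      B.ascending⇒distant (in-π (walk< t<)) (in-π (walk< t+2<))
        (Ascending-transfer (walk< t<) (walk< t+2<)
          (A.distant⇒ascending (walk< t<) (walk< t+2<)
            (≤-reflexive (trans (cong (2 +_) (rankAt-walk t<))
              (trans (sym (trans (+-suc Aα (suc t)) (cong suc (+-suc Aα t)))) (sym (rankAt-walk t+2<)))))))
      where
        t< = <-trans (n<1+n t) (<-trans (n<1+n (suc t)) t+2<)

    image-step : ∀ {t} → 3 ≤ L → suc t < L → suc (image t) ≡ image (suc t)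
    image-step {t} 3≤L t+1< with suc (suc t) <? L
    ... | yes t+2< = proj₁ (unit-steps-climb (image-adjacent (<-trans (n<1+n _) t+2<)) (image-adjacent t+2<)
                                             (image-distant t+2<))
    image-step {zero}  3≤L t+1< | no t+2≮ = ⊥-elim (t+2≮ 3≤L)
    image-step {suc t} 3≤L t+1< | no _    = proj₂ (unit-steps-climb (image-adjacent (<-trans (n<1+n _) t+1<))
                                                    (image-adjacent t+1<) (image-distant t+1<))

    image-linear : ∀ {t} → 3 ≤ L → t < L → image t ≡ image 0 + t
    image-linear {zero}  _   _     = sym (+-identityʳ _)
    image-linear {suc t} 3≤L t+1< =
      trans (sym (image-step 3≤L t+1<))
            (trans (cong suc (image-linear 3≤L (<-trans (n<1+n t) t+1<))) (sym (+-suc _ t)))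

    image-parity : 3 ≤ L → parity (image 0) ≡ parity Aα
    image-parity 3≤L = trans
      (B.inverted-parity _ (in-π (walk< 0<L)) (in-π (walk< 1<L)) (walk-inverted 1<L) (image-step 3≤L 1<L))
      (cong parity (+-identityʳ Aα))
      where
        1<L = ≤-trans (s≤s (s≤s z≤n)) 3≤L
        0<L = <-trans (s≤s z≤n) 1<L

    last<L : 1 ≤ L → L ∸ 1 < L
    last<L = ∸-monoʳ-< {L} {1} {0} (s≤s z≤n)

    low≡image0 : 3 ≤ L → low ≡ image 0
    low≡image0 3≤L = m≤n⇒m⊓n≡m
      (subst (image 0 ≤_) (sym (image-linear 3≤L (last<L (≤-trans (s≤s z≤n) 3≤L)))) (m≤m+n _ _))

    Span : Set
    Span = Σ ℕ λ t₁ → Σ ℕ λ t₂ → t₁ < L × t₂ < L × image t₁ ≡ low × suc (image t₂) ≡ low + L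

    span-≥3 : 3 ≤ L → Span
    span-≥3 3≤L = 0 , L ∸ 1 , 1≤L , last<L 1≤L , sym (low≡image0 3≤L) , (begin
      suc (image (L ∸ 1))     ≡⟨ cong suc (image-linear 3≤L (last<L 1≤L)) ⟩
      suc (image 0 + (L ∸ 1)) ≡⟨ sym (+-suc (image 0) (L ∸ 1)) ⟩
      image 0 + (1 + (L ∸ 1)) ≡⟨ cong₂ _+_ (sym (low≡image0 3≤L)) (m+[n∸m]≡n 1≤L) ⟩
      low + L                 ∎)
      where
        open ≡-Reasoning
        1≤L = ≤-trans (s≤s z≤n) 3≤L

    span-2 : 2 ≡ L → Span
    span-2 2≡L = from-edge (image-adjacent {0} 1<L)
      where
        open ≡-Reasoning
        1<L = subst (1 <_) 2≡L ≤-refl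
        0<L = <-trans (s≤s z≤n) 1<L
        low≡ : low ≡ image 0 ⊓ image 1
        low≡ = cong (λ t → image 0 ⊓ image (t ∸ 1)) (sym 2≡L)
        from-edge : suc (image 0) ≡ image 1 ⊎ suc (image 1) ≡ image 0 → Span
        from-edge (inj₁ up) = 0 , 1 , 0<L , 1<L , sym low≡0 , (begin
          suc (image 1)   ≡⟨ cong suc (sym up) ⟩
          2 + image 0     ≡⟨ +-comm 2 (image 0) ⟩
          image 0 + 2     ≡⟨ cong₂ _+_ (sym low≡0) 2≡L ⟩
          low + L         ∎)
          where low≡0 = trans low≡ (m≤n⇒m⊓n≡m (subst (image 0 ≤_) up (n≤1+n _)))
        from-edge (inj₂ down) = 1 , 0 , 1<L , 0<L , sym low≡1 , (begin
          suc (image 0)   ≡⟨ cong suc (sym down) ⟩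
          2 + image 1     ≡⟨ +-comm 2 (image 1) ⟩
          image 1 + 2     ≡⟨ cong₂ _+_ (sym low≡1) 2≡L ⟩
          low + L         ∎)
          where low≡1 = trans low≡ (m≥n⇒m⊓n≡n (subst (image 1 ≤_) down (n≤1+n _)))

    span : 2 ≤ L → Span
    span 2≤L with m≤n⇒m<n∨m≡n 2≤L
    ... | inj₁ 3≤L = span-≥3 3≤L
    ... | inj₂ 2≡L = span-2 2≡L

    low-parity : 3 ≤ L → parity low ≡ parity Aα
    low-parity 3≤L = trans (cong parity (low≡image0 3≤L)) (image-parity 3≤L)

-- Packings

record Packing (width : ℕ) (residue : Parity) (start end last : ℕ) : Set where
  field
    low       : ℕ → ℕ
    start≤    : start ≤ low 0
    separated : ∀ {c} → c < last → low c + width < low (suc c)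
    ≤end      : low last + width ≤ end
    aligned   : 3 ≤ width → ∀ {c} → c ≤ last → parity (low c) ≡ residue

sum-occurrence⇒Packing : ∀ {α π Aα L Aπ N r} → Window α Aα L → Window π Aπ N → 2 ≤ L →
  Occurrence (sumPow (suc r) α) π → Packing L (parity Aα) Aπ (Aπ + N) r
sum-occurrence⇒Packing {α} {π} {Aα} {L} {Aπ} {N} {r} Wα Wπ 2≤L o@(f , _) = record
  { low       = λ c → OccurrenceRanks.low Wα Wπ (block (length α) f c)
  ; start≤    = start≤
  ; separated = separated
  ; ≤end      = ≤end
  ; aligned   = λ 3≤L {c} c≤r → Copy.low-parity c (copy (s≤s c≤r)) 3≤L
  }
  where
    module A = WindowProperties Wα
    module B = WindowProperties Wπ

    module Copy c = OccurrenceRanks Wα Wπ (block (length α) f c)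

    copy : ∀ {c} → c < suc r → IsOccurrence α π (block (length α) f c)
    copy = block-occurrence o

    start≤ : Aπ ≤ Copy.low 0
    start≤ with Copy.span 0 (copy (s≤s z≤n)) 2≤L
    ... | t₁ , _ , t₁< , _ , image≡low , _ =
      subst (Aπ ≤_) image≡low (proj₁ (Copy.image-range 0 (copy (s≤s z≤n)) t₁<))

    ≤end : Copy.low r + L ≤ Aπ + N
    ≤end with Copy.span r (copy ≤-refl) 2≤L
    ... | _ , t₂ , _ , t₂< , _ , image≡high =
      subst (_≤ Aπ + N) image≡high (proj₂ (Copy.image-range r (copy ≤-refl) t₂<))

    separated : ∀ {c} → c < r → Copy.low c + L < Copy.low (suc c)
    separated {c} c<r with Copy.span c (copy (m<n⇒m<1+n c<r)) 2≤L | Copy.span (suc c) (copy (s≤s c<r)) 2≤L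
    ... | _ , t₂ , _ , t₂< , _ , image≡high | t₁ , _ , t₁< , _ , image≡low , _ =
      subst₂ (λ x y → suc x ≤ y) image≡high image≡low
        (B.ascending⇒distant i< j<
          (positions< , B.ω-order→ i< j< values<))
      where
        occ = copy (m<n⇒m<1+n c<r)
        occ′ = copy (s≤s c<r)
        i< = Copy.in-π c occ (Copy.walk< c occ t₂<)
        j< = Copy.in-π (suc c) occ′ (Copy.walk< (suc c) occ′ t₁<)
        crossing = blocks-ascending o A.entry-range-length (n<1+n c) (s≤s c<r)
                     (Copy.in-α c occ (Copy.walk< c occ t₂<))
                     (Copy.in-α (suc c) occ′ (Copy.walk< (suc c) occ′ t₁<))
        positions< = proj₁ crossing
        values< = proj₂ crossing

stepwise-≤ : ∀ (f : ℕ → ℕ) {d} m → (∀ {c} → c < m → f c + d ≤ f (suc c)) → f 0 + m * d ≤ f m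
stepwise-≤ f     zero    _    = ≤-reflexive (+-identityʳ (f 0))
stepwise-≤ f {d} (suc m) step = begin
  f 0 + (d + m * d) ≡⟨ cong (f 0 +_) (+-comm d (m * d)) ⟩
  f 0 + (m * d + d) ≡⟨ sym (+-assoc (f 0) (m * d) d) ⟩
  f 0 + m * d + d   ≤⟨ +-monoˡ-≤ d (stepwise-≤ f m (λ c<m → step (m<n⇒m<1+n c<m))) ⟩
  f m + d           ≤⟨ step (n<1+n m) ⟩
  f (suc m)         ∎
  where open ≤-Reasoning

packing-length : ∀ {w p A E l} → Packing w p A E l → A + l * suc w + w ≤ E
packing-length {w} {p} {A} {E} {l} P = begin
  A + l * suc w + w     ≤⟨ +-monoˡ-≤ w (+-monoˡ-≤ (l * suc w) start≤) ⟩
  low 0 + l * suc w + w ≤⟨ +-monoˡ-≤ w (stepwise-≤ low l step) ⟩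
  low l + w             ≤⟨ ≤end ⟩
  E                     ∎
  where
    open ≤-Reasoning
    open Packing P
    step : ∀ {c} → c < l → low c + suc w ≤ low (suc c)
    step {c} c<l = ≤-trans (≤-reflexive (+-suc (low c) w)) (separated c<l)

double-+ : ∀ m n → double (m + n) ≡ double m + double n
double-+ zero    n = refl
double-+ (suc m) n = cong (λ x → suc (suc x)) (double-+ m n)

double-mono : ∀ {a b} → a ≤ b → double a ≤ double b
double-mono z≤n       = z≤n
double-mono (s≤s a≤b) = s≤s (s≤s (double-mono a≤b))

double-≤-odd : ∀ {a b} → double a ≤ suc (double b) → a ≤ b
double-≤-odd {zero}              _                 = z≤n
double-≤-odd {suc a} {zero}      (s≤s ())
double-≤-odd {suc a} {suc b}     (s≤s (s≤s 2a≤2b+1)) = s≤s (double-≤-odd 2a≤2b+1)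

double-cancel-≤ : ∀ {a b} → double a ≤ double b → a ≤ b
double-cancel-≤ 2a≤2b = double-≤-odd (m≤n⇒m≤1+n 2a≤2b)

double≡2* : ∀ n → double n ≡ 2 * n
double≡2* zero    = refl
double≡2* (suc n) = trans (cong (λ x → suc (suc x)) (double≡2* n)) (sym (*-suc 2 n))

1≤double⇒1≤ : ∀ {h} → 1 ≤ double h → 1 ≤ h
1≤double⇒1≤ {suc h} _ = s≤s z≤n

parity-halves : ∀ {β} n → β ≤ 1 → parity n ≡ parity β → n ≡ β + double ⌊ n /2⌋
parity-halves {0}           0             _   _  = refl
parity-halves {1}           1             _   _  = refl
parity-halves {suc (suc β)} _             (s≤s ()) _
parity-halves {β}           (suc (suc n)) β≤1 eq =
  trans (cong (λ m → suc (suc m)) (parity-halves n β≤1 eq)) (sym (trans (+-suc β _) (cong suc (+-suc β _))))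

halve-gap : ∀ {s w x y} → double s ≤ 2 + w → double x + w < double y → x + s ≤ y
halve-gap {s} {w} {x} {y} 2s≤2+w gap = double-≤-odd (begin
  double (x + s)           ≡⟨ double-+ x s ⟩
  double x + double s      ≤⟨ +-monoʳ-≤ (double x) 2s≤2+w ⟩
  double x + (2 + w)       ≡⟨ trans (+-suc (double x) (suc w)) (cong suc (+-suc (double x) w)) ⟩
  suc (suc (double x + w)) ≤⟨ s≤s gap ⟩
  suc (double y)           ∎)
  where open ≤-Reasoning

-- When the lows have the parity of β ∈ {0, 1}, write low c = β + 2 h c: the gaps become
-- h c + s ≤ h (c + 1), and σ is the slack 2 s − (β + w).
HalvedPacking : (β s σ A E l : ℕ) → Set
HalvedPacking β s σ A E l = Σ ℕ λ h → A ≤ β + double h × double (h + suc l * s) ≤ σ + E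

aligned-packing-halves : ∀ {w β A E l} s σ →
  β ≤ 1 → 3 ≤ w → double s ≤ 2 + w → σ + (β + w) ≡ double s →
  Packing w (parity β) A E l → HalvedPacking β s σ A E l
aligned-packing-halves {w} {β} {A} {E} {l} s σ β≤1 3≤w 2s≤2+w σ+β+w≡2s P =
  h 0 , subst (A ≤_) (low≡ z≤n) start≤ , (begin
    double (h 0 + (s + l * s))        ≡⟨ cong double (shuffle (h 0) s (l * s)) ⟩
    double (h 0 + l * s + s)          ≡⟨ double-+ (h 0 + l * s) s ⟩
    double (h 0 + l * s) + double s   ≡⟨ cong (double (h 0 + l * s) +_) (sym σ+β+w≡2s) ⟩
    double (h 0 + l * s) + (σ + (β + w)) ≡⟨ regroup (double (h 0 + l * s)) σ β w ⟩
    β + double (h 0 + l * s) + w + σ  ≤⟨ +-monoˡ-≤ σ (+-monoˡ-≤ w (+-monoʳ-≤ β (double-mono chain))) ⟩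
    β + double (h l) + w + σ          ≡⟨ cong (λ x → x + w + σ) (sym (low≡ ≤-refl)) ⟩
    low l + w + σ                     ≤⟨ +-monoˡ-≤ σ ≤end ⟩
    E + σ                             ≡⟨ +-comm E σ ⟩
    σ + E                             ∎)
  where
    open ≤-Reasoning
    open Packing P
    shuffle : ∀ x s m → x + (s + m) ≡ x + m + s
    shuffle = solve-∀
    regroup : ∀ x σ β w → x + (σ + (β + w)) ≡ β + x + w + σ
    regroup = solve-∀
    h : ℕ → ℕ
    h c = ⌊ low c /2⌋
    low≡ : ∀ {c} → c ≤ l → low c ≡ β + double (h c)
    low≡ {c} c≤l = parity-halves (low c) β≤1 (aligned 3≤w c≤l)
    step : ∀ {c} → c < l → h c + s ≤ h (suc c)
    step {c} c<l = halve-gap {s} {w} {h c} 2s≤2+w (+-cancelˡ-< β _ _ (subst₂ _<_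
      (trans (cong (_+ w) (low≡ (<⇒≤ c<l))) (+-assoc β (double (h c)) w)) (low≡ c<l) (separated c<l)))
    chain : h 0 + l * s ≤ h l
    chain = stepwise-≤ h l step




alphaStart : AlphaShape → ℕ
alphaStart a21     = 0
alphaStart (aW _)  = 0
alphaStart (aL _)  = 1
alphaStart (aR _)  = 0
alphaStart (aLR _) = 1

alphaSize : AlphaShape → ℕ
alphaSize a21     = 2
alphaSize (aW k)  = double k
alphaSize (aL k)  = suc (double k)
alphaSize (aR k)  = suc (double k)
alphaSize (aLR k) = suc (suc (double k))

alpha-window : ∀ a → AlphaOK a → Window (alpha a) (alphaStart a) (alphaSize a)
alpha-window a21                _ = odot21-window 0
alpha-window (aW (suc (suc k))) _ = odot21-window (suc k)
alpha-window (aL (suc k))       _ = 1⊙odot21-window k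
alpha-window (aR (suc k))       _ = odot21⊙1-window k
alpha-window (aLR (suc k))      _ = 1⊙odot21⊙1-window k
alpha-window (aW 1)             (s≤s ())

2≤alphaSize : ∀ a → AlphaOK a → 2 ≤ alphaSize a
2≤alphaSize a21                _ = ≤-refl
2≤alphaSize (aW (suc (suc k))) _ = s≤s (s≤s z≤n)
2≤alphaSize (aL (suc k))       _ = s≤s (s≤s z≤n)
2≤alphaSize (aR (suc k))       _ = s≤s (s≤s z≤n)
2≤alphaSize (aLR (suc k))      _ = s≤s (s≤s z≤n)
2≤alphaSize (aW 1)             (s≤s ())

oscStart : OscShape → ℕ
oscStart Weven = 0
oscStart Wodd  = 0
oscStart Meven = 1
oscStart Modd  = 1

oscSize : OscShape → ℕ → ℕ
oscSize Weven n = double n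
oscSize Wodd  n = pred (double n)
oscSize Meven n = double n
oscSize Modd  n = pred (double n)

osc-window : ∀ s n → 2 ≤ n → Window (osc s n) (oscStart s) (oscSize s n)
osc-window Weven (suc (suc m)) _ = odot21-window (suc m)
osc-window Wodd  (suc (suc m)) _ = odot21⊙1-window m
osc-window Meven (suc (suc m)) _ = 1⊙odot21⊙1-window m
osc-window Modd  (suc (suc m)) _ = 1⊙odot21-window m
osc-window s     1             (s≤s ())

4≤length⇒2≤n : ∀ s n → 4 ≤ length (osc s n) → 2 ≤ n
4≤length⇒2≤n s     (suc (suc m)) _ = s≤s (s≤s z≤n)
4≤length⇒2≤n Weven 0 ()
4≤length⇒2≤n Weven 1 (s≤s (s≤s ()))
4≤length⇒2≤n Wodd  0 (s≤s ())
4≤length⇒2≤n Wodd  1 (s≤s ())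
4≤length⇒2≤n Meven 0 (s≤s (s≤s ()))
4≤length⇒2≤n Meven 1 (s≤s (s≤s ()))
4≤length⇒2≤n Modd  0 (s≤s ())
4≤length⇒2≤n Modd  1 (s≤s ())

3≤double : ∀ {k} → 2 ≤ k → 3 ≤ double k
3≤double 2≤k = ≤-trans (n≤1+n 3) (double-mono 2≤k)

3≤suc-double : ∀ {k} → 1 ≤ k → 3 ≤ suc (double k)
3≤suc-double 1≤k = s≤s (double-mono 1≤k)

≤-twice : ∀ {b y n} → b ≡ 2 * y → y ≤ n → b ≤ 2 * n
≤-twice refl y≤n = *-monoʳ-≤ 2 y≤n

≤-twice∸2 : ∀ {b y n} → b ≡ 2 * y ∸ 2 → y ≤ suc n → b ≤ 2 * n
≤-twice∸2 {y = y} {n} refl y≤1+n = begin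
  2 * y ∸ 2       ≤⟨ ∸-monoˡ-≤ 2 (*-monoʳ-≤ 2 y≤1+n) ⟩
  2 * suc n ∸ 2   ≡⟨ cong (_∸ 2) (*-suc 2 n) ⟩
  2 + 2 * n ∸ 2   ≡⟨ m+n∸m≡n 2 (2 * n) ⟩
  2 * n           ∎
  where open ≤-Reasoning

bound-sum : ∀ k r → 2 * k * r + 2 * r ≡ 2 * (r * suc k)
bound-sum = solve-∀

bound-sum+2 : ∀ k r → 2 * k * r + 2 * r + 2 ≡ 2 * suc (r * suc k)
bound-sum+2 = solve-∀

bound-sum² : ∀ k r → 2 * k * r + 4 * r ≡ 2 * (r * suc (suc k))
bound-sum² = solve-∀

packing-bound-W : ∀ s m {k} l →
  HalvedPacking 0 (suc k) 2 (oscStart s) (oscStart s + oscSize s (suc (suc m))) l →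
  bound (aW k) s (suc l) ≤ 2 * suc (suc m)
packing-bound-W Weven m {k} l (h , _ , F) =
  ≤-twice∸2 (cong (_∸ 2) (bound-sum k (suc l))) (≤-trans (m≤n+m _ h) (double-cancel-≤ F))
packing-bound-W Wodd  m {k} l (h , _ , F) =
  ≤-twice (bound-sum k (suc l)) (≤-trans (m≤n+m _ h) (double-≤-odd F))
packing-bound-W Modd  m {k} l (h , 1≤2h , F) =
  ≤-twice (bound-sum k (suc l)) (≤-pred (≤-trans (+-monoˡ-≤ _ (1≤double⇒1≤ 1≤2h)) (double-cancel-≤ F)))
packing-bound-W Meven m {k} l (h , 1≤2h , F) =
  ≤-twice (bound-sum k (suc l)) (≤-pred (≤-trans (+-monoˡ-≤ _ (1≤double⇒1≤ 1≤2h)) (double-≤-odd F)))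

packing-bound-L : ∀ s m {k} l →
  HalvedPacking 1 (suc k) 0 (oscStart s) (oscStart s + oscSize s (suc (suc m))) l →
  bound (aL k) s (suc l) ≤ 2 * suc (suc m)
packing-bound-L Weven m {k} l (h , _ , F) =
  ≤-twice (bound-sum k (suc l)) (≤-trans (m≤n+m _ h) (double-cancel-≤ F))
packing-bound-L Wodd  m {k} l (h , _ , F) =
  ≤-twice (bound-sum+2 k (suc l)) (s≤s (≤-trans (m≤n+m _ h) (double-≤-odd F)))
packing-bound-L Modd  m {k} l (h , _ , F) =
  ≤-twice (bound-sum k (suc l)) (≤-trans (m≤n+m _ h) (double-cancel-≤ F))
packing-bound-L Meven m {k} l (h , _ , F) =
  ≤-twice (bound-sum k (suc l)) (≤-trans (m≤n+m _ h) (double-≤-odd F))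

packing-bound-R : ∀ s m {k} l →
  HalvedPacking 0 (suc k) 1 (oscStart s) (oscStart s + oscSize s (suc (suc m))) l →
  bound (aR k) s (suc l) ≤ 2 * suc (suc m)
packing-bound-R Weven m {k} l (h , _ , F) =
  ≤-twice (bound-sum k (suc l)) (≤-trans (m≤n+m _ h) (double-≤-odd F))
packing-bound-R Wodd  m {k} l (h , _ , F) =
  ≤-twice (bound-sum k (suc l)) (≤-trans (m≤n+m _ h) (double-cancel-≤ F))
packing-bound-R Modd  m {k} l (h , 1≤2h , F) =
  ≤-twice (bound-sum+2 k (suc l)) (≤-trans (+-monoˡ-≤ _ (1≤double⇒1≤ 1≤2h)) (double-≤-odd F))
packing-bound-R Meven m {k} l (h , 1≤2h , F) =
  ≤-twice (bound-sum k (suc l)) (≤-pred (≤-trans (+-monoˡ-≤ _ (1≤double⇒1≤ 1≤2h)) (double-cancel-≤ F)))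

packing-bound-LR : ∀ s m {k} l →
  HalvedPacking 1 (suc (suc k)) 1 (oscStart s) (oscStart s + oscSize s (suc (suc m))) l →
  bound (aLR k) s (suc l) ≤ 2 * suc (suc m)
packing-bound-LR Weven m {k} l (h , _ , F) =
  ≤-twice (bound-sum² k (suc l)) (≤-trans (m≤n+m _ h) (double-≤-odd F))
packing-bound-LR Wodd  m {k} l (h , _ , F) =
  ≤-twice (bound-sum² k (suc l)) (≤-trans (m≤n+m _ h) (double-cancel-≤ F))
packing-bound-LR Modd  m {k} l (h , _ , F) =
  ≤-twice (bound-sum² k (suc l)) (≤-trans (m≤n+m _ h) (double-≤-odd F))
packing-bound-LR Meven m {k} l (h , _ , F) =
  ≤-twice∸2 (cong (_∸ 2) (bound-sum² k (suc l))) (≤-trans (m≤n+m _ h) (double-cancel-≤ F))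

three-copies : ∀ l → 3 * suc l ≡ suc (l * 3 + 2)
three-copies = solve-∀

packing-bound-21 : ∀ s m l →
  Packing 2 0ℙ (oscStart s) (oscStart s + oscSize s (suc (suc m))) l →
  bound a21 s (suc l) ≤ 2 * suc (suc m)
packing-bound-21 Weven m l P =
  subst₂ _≤_ (cong (_∸ 1) (sym (three-copies l))) (double≡2* (suc (suc m))) (packing-length P)
packing-bound-21 Wodd  m l P =
  subst₂ _≤_ (sym (three-copies l)) (double≡2* (suc (suc m))) (s≤s (packing-length P))
packing-bound-21 Modd  m l P =
  subst₂ _≤_ (sym (three-copies l)) (double≡2* (suc (suc m))) (packing-length P)
packing-bound-21 Meven m l P =
  subst₂ _≤_ (cong (_∸ 1) (sym (three-copies l))) (double≡2* (suc (suc m))) (≤-pred (packing-length P))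

packing-bound : ∀ s n a l → 2 ≤ n → AlphaOK a →
  Packing (alphaSize a) (parity (alphaStart a)) (oscStart s) (oscStart s + oscSize s n) l →
  bound a s (suc l) ≤ 2 * n
packing-bound s (suc (suc m)) a21 l _ _ P = packing-bound-21 s m l P
packing-bound s (suc (suc m)) (aW k) l _ 2≤k P =
  packing-bound-W s m l (aligned-packing-halves (suc k) 2 z≤n (3≤double 2≤k) ≤-refl refl P)
packing-bound s (suc (suc m)) (aL k) l _ 1≤k P =
  packing-bound-L s m l (aligned-packing-halves (suc k) 0 (s≤s z≤n) (3≤suc-double 1≤k) (n≤1+n _) refl P)
packing-bound s (suc (suc m)) (aR k) l _ 1≤k P =
  packing-bound-R s m l (aligned-packing-halves (suc k) 1 z≤n (3≤suc-double 1≤k) (n≤1+n _) refl P)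
packing-bound s (suc (suc m)) (aLR k) l _ 1≤k P =
  packing-bound-LR s m l
    (aligned-packing-halves (suc (suc k)) 1 (s≤s z≤n) (m≤n⇒m≤1+n (3≤suc-double 1≤k)) ≤-refl refl P)
packing-bound s 1             a       l (s≤s ())

lemma16 : (s : OscShape) (n : ℕ) (r : ℕ) (a : AlphaShape) →
    4 ≤ length (osc s n) → 1 ≤ r → AlphaOK a →
    sumPow r (alpha a) ≼ osc s n →
    bound a s r ≤ 2 * n
lemma16 s n zero    a _        ()
lemma16 s n (suc l) a 4≤length _ ok α⊕≼π =
  packing-bound s n a l 2≤n ok
    (sum-occurrence⇒Packing (alpha-window a ok) (osc-window s n 2≤n) (2≤alphaSize a ok) (≼⇒Occurrence α⊕≼π))
  where
    2≤n = 4≤length⇒2≤n s n 4≤length
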